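{- Let $r$ and $t$ be positive integers with $r\ge 3$ and $2\le t\le \frac{r+4}{4}$, and let $n=3r-t$. If $\rho_2(n,r)\ge 5$, then there exists a 2-packing $S$ of $K(n,r)$ with $|S|=5$ and $i_x(S)\le 2$ for every $x\in[n]$.
   Context: For integers $n\ge 2r\ge 2$, the Kneser graph $K(n,r)$ has as vertices the $r$-element subsets of $[n]=\{1,\dots,n\}$, two vertices being adjacent iff they are disjoint. A 2-packing of a graph is a set of vertices that are pairwise at distance at least $3$ (no two adjacent and no two with a common neighbor); $\rho_2(n,r)$ is the maximum cardinality of a 2-packing of $K(n,r)$. For a set $S$ of vertices of $K(n,r)$ and $x\in[n]$, $i_x(S)=|\{u\in S: x\in u\}|$ is the number of vertices of $S$ containing $x$. -}

module Defs where

open import Data.Nat using (ℕ)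
open import Data.Fin using (Fin)
open import Data.Fin.Subset using (Subset; ∣_∣; _∩_; Empty; _∈_; _∉_)
open import Data.Fin.Subset using () renaming (⊥ to ∅)
open import Data.List using (List; length; filter)
open import Data.List.Relation.Unary.All using (All)
open import Data.List.Relation.Unary.AllPairs using (AllPairs)
open import Data.Fin.Subset.Properties using (_∈?_)
open import Data.Product using (∃; _×_)
open import Relation.Binary.PropositionalEquality using (_≡_; _≢_)
open import Relation.Nullary using (¬_)

IsVertex : (n r : ℕ) → Subset n → Set
IsVertex n r u = ∣ u ∣ ≡ r

Disjoint : ∀ {n} → Subset n → Subset n → Set
Disjoint u v = Empty (u ∩ v)

-- Two distinct vertices are at distance at least 3 in K(n,r):
-- they are not adjacent and have no common neighbour.
FarApart : (n r : ℕ) → Subset n → Subset n → Set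
FarApart n r u v =
  ¬ Disjoint u v ×
  ¬ (∃ λ (w : Subset n) → IsVertex n r w × Disjoint w u × Disjoint w v)

Is2Packing : (n r : ℕ) → List (Subset n) → Set
Is2Packing n r S =
  All (IsVertex n r) S ×
  AllPairs (λ u v → u ≢ v × FarApart n r u v) S

-- ρ₂(n,r) ≥ k : there is a 2-packing of cardinality k.
ρ₂≥ : (n r k : ℕ) → Set
ρ₂≥ n r k = ∃ λ S → Is2Packing n r S × length S ≡ k

i : ∀ {n} → Fin n → List (Subset n) → ℕ
i x S = length (filter (λ u → x ∈? u) S)

{-# OPTIONS --safe #-}
module Submission where

-- Write t = c + 1, so that n + t = 3r. A common neighbour of two r-sets u and v is an r-subset of
-- the complement of u ∪ v, which has n − 2r + |u ∩ v| elements; hence u and v are at distance at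
-- least 3 exactly when 1 ≤ |u ∩ v| ≤ c. For a 2-packing S of five sets, Bonferroni's inequality
-- Σ|u| ≤ Σ|u ∩ v| + |⋃ S| gives 5r ≤ 10c + n, that is 2r + t ≤ 10c. Conversely, this inequality
-- lets us split 2r + t into ten parts in [1, c], one block of points for each pair of five sets,
-- and complete every set by private points to r elements (possible as 4c ≤ r). The five sets then
-- meet exactly in the pair blocks, use 5r − (2r + t) = n points, and no point lies in three of them.

open import Defs
open import Data.Bool using (_∧_)
open import Data.Fin using (Fin; zero; suc; splitAt)
open import Data.Fin.Properties using (all?)
open import Data.Fin.Subset using (Subset; inside; outside; ∣_∣; _∩_; _∪_; ∁; ⋃; _∈_; _⊆_; Empty; ⊥)
open import Data.Fin.Subset.Properties
open import Data.List using (List; []; _∷_; length; map)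
open import Data.List.Relation.Unary.All as All using (All; []; _∷_)
import Data.List.Relation.Unary.All.Properties as All
open import Data.List.Relation.Unary.AllPairs using (AllPairs; []; _∷_)
import Data.List.Relation.Unary.AllPairs.Properties as AllPairs
open import Data.Nat using (ℕ; zero; suc; _≤_; _<_; _*_; _+_; _∸_; z≤n; s≤s; _≤?_; _≡ᵇ_)
open import Data.Nat.Combinatorics using (_C_; nC1≡n; nCk+nC[k+1]≡[n+1]C[k+1])
open import Data.Nat.ListAction using (sum)
open import Data.Nat.Properties
open import Algebra.Properties.CommutativeSemigroup +-commutativeSemigroup using (x∙yz≈y∙xz; x∙yz≈zx∙y)
open import Data.Nat.Tactic.RingSolver using (solve-∀)
open import Data.Product using (∃; _×_; _,_; proj₁; proj₂)
open import Data.Sum using (inj₁; inj₂; [_,_]′)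
open import Data.Vec as Vec using (Vec; []; _∷_; _++_; replicate; lookup; here; there)
open import Data.Vec.Properties
  using (zipWith-++; zipWith-replicate; lookup-splitAt; lookup-replicate; []=⇒lookup; lookup⇒[]=)
open import Data.Vec.Relation.Unary.All as VecAll using ([]; _∷_)
import Data.Vec.Relation.Unary.All.Properties as VecAll
open import Function using (_∘_; case_of_)
open import Function.Bundles using (_⇔_; mk⇔; Equivalence)
open import Relation.Binary.PropositionalEquality
open import Relation.Nullary using (¬_; contradiction; yes; no)
open import Relation.Nullary.Decidable using (from-yes)

open Equivalence using (to; from)

∣p∪q∣+∣p∩q∣≡∣p∣+∣q∣ : ∀ {n} (p q : Subset n) → ∣ p ∪ q ∣ + ∣ p ∩ q ∣ ≡ ∣ p ∣ + ∣ q ∣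
∣p∪q∣+∣p∩q∣≡∣p∣+∣q∣ []            []            = refl
∣p∪q∣+∣p∩q∣≡∣p∣+∣q∣ (inside  ∷ p) (inside  ∷ q) = cong suc (begin
  ∣ p ∪ q ∣ + suc ∣ p ∩ q ∣   ≡⟨ +-suc _ _ ⟩
  suc (∣ p ∪ q ∣ + ∣ p ∩ q ∣) ≡⟨ cong suc (∣p∪q∣+∣p∩q∣≡∣p∣+∣q∣ p q) ⟩
  suc (∣ p ∣ + ∣ q ∣)         ≡⟨ +-suc _ _ ⟨
  ∣ p ∣ + suc ∣ q ∣           ∎)
  where open ≡-Reasoning
∣p∪q∣+∣p∩q∣≡∣p∣+∣q∣ (inside  ∷ p) (outside ∷ q) = cong suc (∣p∪q∣+∣p∩q∣≡∣p∣+∣q∣ p q)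
∣p∪q∣+∣p∩q∣≡∣p∣+∣q∣ (outside ∷ p) (inside  ∷ q) =
  trans (cong suc (∣p∪q∣+∣p∩q∣≡∣p∣+∣q∣ p q)) (sym (+-suc _ _))
∣p∪q∣+∣p∩q∣≡∣p∣+∣q∣ (outside ∷ p) (outside ∷ q) = ∣p∪q∣+∣p∩q∣≡∣p∣+∣q∣ p q

∣p∪q∣≤∣p∣+∣q∣ : ∀ {n} (p q : Subset n) → ∣ p ∪ q ∣ ≤ ∣ p ∣ + ∣ q ∣
∣p∪q∣≤∣p∣+∣q∣ p q = ≤-trans (m≤m+n _ _) (≤-reflexive (∣p∪q∣+∣p∩q∣≡∣p∣+∣q∣ p q))

∣p∩q∣<∣p∣⇒p≢q : ∀ {n} {p q : Subset n} → ∣ p ∩ q ∣ < ∣ p ∣ → p ≢ q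
∣p∩q∣<∣p∣⇒p≢q {p = p} ∣p∩q∣<∣p∣ refl = <-irrefl (cong ∣_∣ (∩-idem p)) ∣p∩q∣<∣p∣

0<∣p∣⇒¬Empty : ∀ {n} {p : Subset n} → 0 < ∣ p ∣ → ¬ Empty p
0<∣p∣⇒¬Empty {n} 0<∣p∣ empty =
  <-irrefl (sym (trans (cong ∣_∣ (Empty-unique empty)) (∣⊥∣≡0 n))) 0<∣p∣

⊆-ofSize : ∀ {n} (p : Subset n) {k} → k ≤ ∣ p ∣ → ∃ λ w → ∣ w ∣ ≡ k × w ⊆ p
⊆-ofSize {n} p {zero} _ = ⊥ , ∣⊥∣≡0 n , ⊥⊆
⊆-ofSize (inside ∷ p) {suc k} (s≤s k≤∣p∣) with ⊆-ofSize p k≤∣p∣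
... | w , ∣w∣≡k , w⊆p = inside ∷ w , cong suc ∣w∣≡k , λ { here → here ; (there x∈w) → there (w⊆p x∈w) }
⊆-ofSize (outside ∷ p) {suc k} k<∣p∣ with ⊆-ofSize p k<∣p∣
... | w , ∣w∣≡k , w⊆p = outside ∷ w , ∣w∣≡k , λ { (there x∈w) → there (w⊆p x∈w) }

⊆∁⇒disjoint : ∀ {n} {w s t : Subset n} → w ⊆ ∁ t → s ⊆ t → Disjoint w s
⊆∁⇒disjoint {w = w} {s} w⊆∁t s⊆t (x , x∈w∩s) =
  let x∈w , x∈s = x∈p∩q⁻ w s x∈w∩s in x∈∁p⇒x∉p (w⊆∁t x∈w) (s⊆t x∈s)

disjoint⇒⊆∁[p∪q] : ∀ {n} {w p q : Subset n} → Disjoint w p → Disjoint w q → w ⊆ ∁ (p ∪ q)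
disjoint⇒⊆∁[p∪q] {p = p} {q} w∩p=∅ w∩q=∅ {x} x∈w = x∉p⇒x∈∁p λ x∈p∪q → case x∈p∪q⁻ p q x∈p∪q of λ
  { (inj₁ x∈p) → w∩p=∅ (x , x∈p∩q⁺ (x∈w , x∈p))
  ; (inj₂ x∈q) → w∩q=∅ (x , x∈p∩q⁺ (x∈w , x∈q))
  }

CommonNeighbour : (n r : ℕ) → Subset n → Subset n → Set
CommonNeighbour n r u v = ∃ λ w → IsVertex n r w × Disjoint w u × Disjoint w v

commonNeighbour⇔r≤∣∁[u∪v]∣ : ∀ {n r} {u v : Subset n} → CommonNeighbour n r u v ⇔ r ≤ ∣ ∁ (u ∪ v) ∣
commonNeighbour⇔r≤∣∁[u∪v]∣ {u = u} {v} = mk⇔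
  (λ (w , ∣w∣≡r , w∩u=∅ , w∩v=∅) → subst (_≤ _) ∣w∣≡r (p⊆q⇒∣p∣≤∣q∣ (disjoint⇒⊆∁[p∪q] w∩u=∅ w∩v=∅)))
  (λ r≤∣∁[u∪v]∣ → let w , ∣w∣≡r , w⊆∁[u∪v] = ⊆-ofSize (∁ (u ∪ v)) r≤∣∁[u∪v]∣
                   in w , ∣w∣≡r , ⊆∁⇒disjoint w⊆∁[u∪v] (p⊆p∪q v) , ⊆∁⇒disjoint w⊆∁[u∪v] (q⊆p∪q u v))

r≤n∸U⇔c<I : ∀ {n r c U I} → U ≤ n → r + U + I ≡ n + suc c → r ≤ n ∸ U ⇔ c < I
r≤n∸U⇔c<I {n} {r} {c} {U} {I} U≤n r+U+I≡n+1+c = mk⇔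
  (λ r≤n∸U → +-cancelˡ-≤ (r + U) _ _ (begin
    r + U + suc c ≤⟨ +-monoˡ-≤ (suc c) (m≤o∸n⇒m+n≤o r U≤n r≤n∸U) ⟩
    n + suc c     ≡⟨ r+U+I≡n+1+c ⟨
    r + U + I     ∎))
  (λ c<I → m+n≤o⇒m≤o∸n r (+-cancelʳ-≤ (suc c) _ _ (begin
    r + U + suc c ≤⟨ +-monoʳ-≤ (r + U) c<I ⟩
    r + U + I     ≡⟨ r+U+I≡n+1+c ⟩
    n + suc c     ∎)))
  where open ≤-Reasoning

r≤∣∁[u∪v]∣⇔c<∣u∩v∣ : ∀ {n r c} {u v : Subset n} → n + suc c ≡ 3 * r → ∣ u ∣ ≡ r → ∣ v ∣ ≡ r →
                      r ≤ ∣ ∁ (u ∪ v) ∣ ⇔ c < ∣ u ∩ v ∣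
r≤∣∁[u∪v]∣⇔c<∣u∩v∣ {n} {r} {c} {u} {v} n+1+c≡3r ∣u∣≡r ∣v∣≡r =
  subst (λ k → r ≤ k ⇔ c < ∣ u ∩ v ∣) (sym (∣∁p∣≡n∸∣p∣ (u ∪ v))) (r≤n∸U⇔c<I (∣p∣≤n (u ∪ v)) (begin
    r + ∣ u ∪ v ∣ + ∣ u ∩ v ∣   ≡⟨ +-assoc r _ _ ⟩
    r + (∣ u ∪ v ∣ + ∣ u ∩ v ∣) ≡⟨ cong (r +_) (∣p∪q∣+∣p∩q∣≡∣p∣+∣q∣ u v) ⟩
    r + (∣ u ∣ + ∣ v ∣)         ≡⟨ cong₂ (λ a b → r + (a + b)) ∣u∣≡r (trans ∣v∣≡r (sym (+-identityʳ r))) ⟩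
    3 * r                       ≡⟨ n+1+c≡3r ⟨
    n + suc c                   ∎))
  where open ≡-Reasoning

farApart⇒∣u∩v∣≤c : ∀ {n r c} {u v : Subset n} → n + suc c ≡ 3 * r → ∣ u ∣ ≡ r → ∣ v ∣ ≡ r →
                    FarApart n r u v → ∣ u ∩ v ∣ ≤ c
farApart⇒∣u∩v∣≤c {u = u} {v} n+1+c≡3r ∣u∣≡r ∣v∣≡r (_ , noCommonNeighbour) = ≮⇒≥
  ( noCommonNeighbour
  ∘ from commonNeighbour⇔r≤∣∁[u∪v]∣
  ∘ from (r≤∣∁[u∪v]∣⇔c<∣u∩v∣ {u = u} {v} n+1+c≡3r ∣u∣≡r ∣v∣≡r))

1≤∣u∩v∣≤c⇒farApart : ∀ {n r c} {u v : Subset n} → n + suc c ≡ 3 * r → ∣ u ∣ ≡ r → ∣ v ∣ ≡ r →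
                      1 ≤ ∣ u ∩ v ∣ → ∣ u ∩ v ∣ ≤ c → FarApart n r u v
1≤∣u∩v∣≤c⇒farApart {u = u} {v} n+1+c≡3r ∣u∣≡r ∣v∣≡r 1≤∣u∩v∣ ∣u∩v∣≤c =
  0<∣p∣⇒¬Empty 1≤∣u∩v∣ ,
  λ common → <⇒≱
    (to (r≤∣∁[u∪v]∣⇔c<∣u∩v∣ {u = u} {v} n+1+c≡3r ∣u∣≡r ∣v∣≡r) (to commonNeighbour⇔r≤∣∁[u∪v]∣ common))
    ∣u∩v∣≤c

AllPairs-mapWithAll : ∀ {A : Set} {P : A → Set} {R S : A → A → Set} →
                      (∀ {x y} → P x → P y → R x y → S x y) →
                      ∀ {xs} → All P xs → AllPairs R xs → AllPairs S xs
AllPairs-mapWithAll f []         []         = []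
AllPairs-mapWithAll f (px ∷ pxs) (rx ∷ rxs) =
  All.zipWith (λ (py , rxy) → f px py rxy) (pxs , rx) ∷ AllPairs-mapWithAll f pxs rxs

pairSum : ∀ {A : Set} → (A → A → ℕ) → List A → ℕ
pairSum f []       = 0
pairSum f (x ∷ xs) = sum (map (f x) xs) + pairSum f xs

sum-map-const : ∀ {A : Set} {f : A → ℕ} {c} {xs} → All (λ x → f x ≡ c) xs → sum (map f xs) ≡ length xs * c
sum-map-const []             = refl
sum-map-const (fx≡c ∷ fxs≡c) = cong₂ _+_ fx≡c (sum-map-const fxs≡c)

sum-map-mono : ∀ {A : Set} {f g : A → ℕ} {xs} → All (λ x → f x ≤ g x) xs → sum (map f xs) ≤ sum (map g xs)
sum-map-mono []                = z≤n
sum-map-mono (fx≤gx ∷ fxs≤gxs) = +-mono-≤ fx≤gx (sum-map-mono fxs≤gxs)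

pairSum-mono : ∀ {A : Set} {f g : A → A → ℕ} {xs} → AllPairs (λ x y → f x y ≤ g x y) xs →
               pairSum f xs ≤ pairSum g xs
pairSum-mono []                = z≤n
pairSum-mono (fx≤gx ∷ fxs≤gxs) = +-mono-≤ (sum-map-mono fx≤gx) (pairSum-mono fxs≤gxs)

pairSum-const : ∀ {A : Set} c (xs : List A) → pairSum (λ _ _ → c) xs ≡ (length xs C 2) * c
pairSum-const c []       = refl
pairSum-const c (x ∷ xs) = begin
  sum (map (λ _ → c) xs) + pairSum (λ _ _ → c) xs
    ≡⟨ cong₂ _+_ (sum-map-const (All.universal (λ _ → refl) xs)) (pairSum-const c xs) ⟩
  length xs * c + (length xs C 2) * c ≡⟨ *-distribʳ-+ c (length xs) _ ⟨
  (length xs + length xs C 2) * c     ≡⟨ cong (λ k → (k + length xs C 2) * c) (nC1≡n (length xs)) ⟨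
  (length xs C 1 + length xs C 2) * c ≡⟨ cong (_* c) (nCk+nC[k+1]≡[n+1]C[k+1] (length xs) 1) ⟩
  (suc (length xs) C 2) * c           ∎
  where open ≡-Reasoning

∣p∩⋃qs∣≤∑∣p∩q∣ : ∀ {n} (p : Subset n) qs → ∣ p ∩ ⋃ qs ∣ ≤ sum (map (λ q → ∣ p ∩ q ∣) qs)
∣p∩⋃qs∣≤∑∣p∩q∣ {n} p []       = ≤-reflexive (trans (cong ∣_∣ (∩-zeroʳ p)) (∣⊥∣≡0 n))
∣p∩⋃qs∣≤∑∣p∩q∣     p (q ∷ qs) = begin
  ∣ p ∩ (q ∪ ⋃ qs) ∣                          ≡⟨ cong ∣_∣ (∩-distribˡ-∪ p q (⋃ qs)) ⟩
  ∣ p ∩ q ∪ p ∩ ⋃ qs ∣                        ≤⟨ ∣p∪q∣≤∣p∣+∣q∣ (p ∩ q) (p ∩ ⋃ qs) ⟩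
  ∣ p ∩ q ∣ + ∣ p ∩ ⋃ qs ∣                    ≤⟨ +-monoʳ-≤ ∣ p ∩ q ∣ (∣p∩⋃qs∣≤∑∣p∩q∣ p qs) ⟩
  ∣ p ∩ q ∣ + sum (map (λ q → ∣ p ∩ q ∣) qs)  ∎
  where open ≤-Reasoning

bonferroni : ∀ {n} (ps : List (Subset n)) → sum (map ∣_∣ ps) ≤ pairSum (λ p q → ∣ p ∩ q ∣) ps + ∣ ⋃ ps ∣
bonferroni []       = z≤n
bonferroni (p ∷ ps) = begin
  ∣ p ∣ + sum (map ∣_∣ ps)               ≤⟨ +-monoʳ-≤ ∣ p ∣ (bonferroni ps) ⟩
  ∣ p ∣ + (P + ∣ ⋃ ps ∣)                 ≡⟨ x∙yz≈y∙xz ∣ p ∣ P _ ⟩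
  P + (∣ p ∣ + ∣ ⋃ ps ∣)                 ≡⟨ cong (P +_) (∣p∪q∣+∣p∩q∣≡∣p∣+∣q∣ p (⋃ ps)) ⟨
  P + (∣ p ∪ ⋃ ps ∣ + ∣ p ∩ ⋃ ps ∣)      ≤⟨ +-monoʳ-≤ P (+-monoʳ-≤ ∣ p ∪ ⋃ ps ∣ (∣p∩⋃qs∣≤∑∣p∩q∣ p ps)) ⟩
  P + (∣ p ∪ ⋃ ps ∣ + Σ∣p∩q∣)            ≡⟨ x∙yz≈zx∙y P ∣ p ∪ ⋃ ps ∣ Σ∣p∩q∣ ⟩
  Σ∣p∩q∣ + P + ∣ p ∪ ⋃ ps ∣              ∎
  where
  open ≤-Reasoning
  P = pairSum (λ p q → ∣ p ∩ q ∣) ps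
  Σ∣p∩q∣ = sum (map (λ q → ∣ p ∩ q ∣) ps)

2packing-size-bound : ∀ {n r c S} → n + suc c ≡ 3 * r → Is2Packing n r S →
                      length S * r ≤ (length S C 2) * c + n
2packing-size-bound {n} {r} {c} {S} n+1+c≡3r (sizes , farPairs) = begin
  length S * r                             ≡⟨ sum-map-const sizes ⟨
  sum (map ∣_∣ S)                          ≤⟨ bonferroni S ⟩
  pairSum (λ u v → ∣ u ∩ v ∣) S + ∣ ⋃ S ∣  ≤⟨ +-mono-≤ (pairSum-mono ∣u∩v∣≤c) (∣p∣≤n (⋃ S)) ⟩
  pairSum (λ _ _ → c) S + n                ≡⟨ cong (_+ n) (pairSum-const c S) ⟩
  (length S C 2) * c + n                   ∎
  where
  open ≤-Reasoning
  ∣u∩v∣≤c : AllPairs (λ u v → ∣ u ∩ v ∣ ≤ c) S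
  ∣u∩v∣≤c = AllPairs-mapWithAll
    (λ ∣u∣≡r ∣v∣≡r (_ , far) → farApart⇒∣u∩v∣≤c n+1+c≡3r ∣u∣≡r ∣v∣≡r far) sizes farPairs

1≤_≤_ : ℕ → ℕ → Set
1≤ a ≤ c = 1 ≤ a × a ≤ c

partition-bounded : ∀ k {c q} → q ≤ k * c → ∃ λ (v : Vec ℕ k) → VecAll.All (_≤ c) v × Vec.sum v ≡ q
partition-bounded zero    q≤0 = [] , [] , sym (n≤0⇒n≡0 q≤0)
partition-bounded (suc k) {c} {q} q≤c+k*c with q ≤? c
... | yes q≤c = let v , v≤c , Σv≡0 = partition-bounded k z≤n
                in q ∷ v , q≤c ∷ v≤c , trans (cong (q +_) Σv≡0) (+-identityʳ q)
... | no  q≰c = let v , v≤c , Σv≡q∸c = partition-bounded k (m≤n+o⇒m∸n≤o q c q≤c+k*c)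
                in c ∷ v , ≤-refl ∷ v≤c , trans (cong (c +_) Σv≡q∸c) (m+[n∸m]≡n (<⇒≤ (≰⇒> q≰c)))

sum-map-suc : ∀ {k} (v : Vec ℕ k) → Vec.sum (Vec.map suc v) ≡ k + Vec.sum v
sum-map-suc         []      = refl
sum-map-suc {suc k} (a ∷ v) = cong suc (trans (cong (a +_) (sum-map-suc v)) (x∙yz≈y∙xz a k _))

partition-positive : ∀ k {c q} → k ≤ q → q ≤ k * suc c →
                     ∃ λ (v : Vec ℕ k) → VecAll.All (1≤_≤ suc c) v × Vec.sum v ≡ q
partition-positive k {c} {q} k≤q q≤k*[1+c] =
  let v , v≤c , Σv≡q∸k = partition-bounded k (m≤n+o⇒m∸n≤o q k (subst (q ≤_) (*-suc k c) q≤k*[1+c]))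
  in Vec.map suc v ,
     VecAll.map⁺ (VecAll.map (λ a≤c → s≤s z≤n , s≤s a≤c) v≤c) ,
     trans (sum-map-suc v) (trans (cong (k +_) Σv≡q∸k) (m+[n∸m]≡n k≤q))

blowUp : ∀ {k} (ms : Vec ℕ k) → Subset k → Subset (Vec.sum ms)
blowUp []       []      = []
blowUp (m ∷ ms) (b ∷ p) = replicate m b ++ blowUp ms p

weight : ∀ {k} → Vec ℕ k → Subset k → ℕ
weight []       []            = 0
weight (m ∷ ms) (inside  ∷ p) = m + weight ms p
weight (m ∷ ms) (outside ∷ p) = weight ms p

∣p++q∣≡∣p∣+∣q∣ : ∀ {m n} (p : Subset m) (q : Subset n) → ∣ p ++ q ∣ ≡ ∣ p ∣ + ∣ q ∣
∣p++q∣≡∣p∣+∣q∣ []            q = refl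
∣p++q∣≡∣p∣+∣q∣ (inside  ∷ p) q = cong suc (∣p++q∣≡∣p∣+∣q∣ p q)
∣p++q∣≡∣p∣+∣q∣ (outside ∷ p) q = ∣p++q∣≡∣p∣+∣q∣ p q

∣blowUp∣≡weight : ∀ {k} (ms : Vec ℕ k) p → ∣ blowUp ms p ∣ ≡ weight ms p
∣blowUp∣≡weight []       []            = refl
∣blowUp∣≡weight (m ∷ ms) (inside  ∷ p) =
  trans (∣p++q∣≡∣p∣+∣q∣ (replicate m inside) _) (cong₂ _+_ (∣⊤∣≡n m) (∣blowUp∣≡weight ms p))
∣blowUp∣≡weight (m ∷ ms) (outside ∷ p) =
  trans (∣p++q∣≡∣p∣+∣q∣ (replicate m outside) _) (cong₂ _+_ (∣⊥∣≡0 m) (∣blowUp∣≡weight ms p))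

blowUp-∩ : ∀ {k} (ms : Vec ℕ k) p q → blowUp ms p ∩ blowUp ms q ≡ blowUp ms (p ∩ q)
blowUp-∩ []       []      []      = refl
blowUp-∩ (m ∷ ms) (a ∷ p) (b ∷ q) =
  trans (zipWith-++ _∧_ (replicate m a) (blowUp ms p) (replicate m b) (blowUp ms q))
        (cong₂ _++_ (zipWith-replicate _∧_ a b) (blowUp-∩ ms p q))

block : ∀ {k} (ms : Vec ℕ k) → Fin (Vec.sum ms) → Fin k
block (m ∷ ms) x = [ (λ _ → zero) , suc ∘ block ms ]′ (splitAt m x)

lookup-blowUp : ∀ {k} (ms : Vec ℕ k) p x → lookup (blowUp ms p) x ≡ lookup p (block ms x)
lookup-blowUp (m ∷ ms) (b ∷ p) x rewrite lookup-splitAt m (replicate m b) (blowUp ms p) x with splitAt m x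
... | inj₁ j = lookup-replicate j b
... | inj₂ j = lookup-blowUp ms p j

∈-blowUp⇔ : ∀ {k} (ms : Vec ℕ k) p x → x ∈ blowUp ms p ⇔ block ms x ∈ p
∈-blowUp⇔ ms p x = mk⇔
  (λ x∈ → lookup⇒[]= (block ms x) p (trans (sym (lookup-blowUp ms p x)) ([]=⇒lookup x∈)))
  (λ bx∈ → lookup⇒[]= x (blowUp ms p) (trans (lookup-blowUp ms p x) ([]=⇒lookup bx∈)))

i-map : ∀ {m n} {x : Fin m} {y : Fin n} (f : Subset n → Subset m) →
        (∀ p → x ∈ f p ⇔ y ∈ p) → ∀ ps → i x (map f ps) ≡ i y ps
i-map f x∈f⇔y∈ []       = refl
i-map {x = x} {y} f x∈f⇔y∈ (p ∷ ps) with x ∈? f p | y ∈? p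
... | yes _    | yes _    = cong suc (i-map f x∈f⇔y∈ ps)
... | no  _    | no  _    = i-map f x∈f⇔y∈ ps
... | yes x∈fp | no  y∉p  = contradiction (to (x∈f⇔y∈ p) x∈fp) y∉p
... | no  x∉fp | yes y∈p  = contradiction (from (x∈f⇔y∈ p) y∈p) x∉fp

i-blowUp : ∀ {k} (ms : Vec ℕ k) x ps → i x (map (blowUp ms) ps) ≡ i (block ms x) ps
i-blowUp ms x = i-map (blowUp ms) (λ p → ∈-blowUp⇔ ms p x)

blowUp-2packing : ∀ {k r c} {ms : Vec ℕ k} {ps} → Vec.sum ms + suc c ≡ 3 * r → c < r →
                  All (λ p → weight ms p ≡ r) ps → AllPairs (λ p q → 1≤ weight ms (p ∩ q) ≤ c) ps →
                  Is2Packing (Vec.sum ms) r (map (blowUp ms) ps)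
blowUp-2packing {r = r} {c} {ms} n+1+c≡3r c<r weights overlaps =
  All.map⁺ (All.map (λ {p} → trans (∣blowUp∣≡weight ms p)) weights) ,
  AllPairs.map⁺ (AllPairs-mapWithAll distinctFarApart weights overlaps)
  where
  ∣∩∣≡weight : ∀ p q → ∣ blowUp ms p ∩ blowUp ms q ∣ ≡ weight ms (p ∩ q)
  ∣∩∣≡weight p q = trans (cong ∣_∣ (blowUp-∩ ms p q)) (∣blowUp∣≡weight ms (p ∩ q))
  distinctFarApart : ∀ {p q} → weight ms p ≡ r → weight ms q ≡ r → 1≤ weight ms (p ∩ q) ≤ c →
                     blowUp ms p ≢ blowUp ms q × FarApart (Vec.sum ms) r (blowUp ms p) (blowUp ms q)
  distinctFarApart {p} {q} wp≡r wq≡r (1≤w , w≤c) =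
    ∣p∩q∣<∣p∣⇒p≢q (subst₂ _<_ (sym (∣∩∣≡weight p q)) (sym ∣u∣≡r) (≤-<-trans w≤c c<r)) ,
    1≤∣u∩v∣≤c⇒farApart n+1+c≡3r ∣u∣≡r ∣v∣≡r
      (subst (1 ≤_) (sym (∣∩∣≡weight p q)) 1≤w) (subst (_≤ c) (sym (∣∩∣≡weight p q)) w≤c)
    where
    ∣u∣≡r = trans (∣blowUp∣≡weight ms p) wp≡r
    ∣v∣≡r = trans (∣blowUp∣≡weight ms q) wq≡r

LowDegree2Packing : (n r k : ℕ) → Set
LowDegree2Packing n r k = ∃ λ S → Is2Packing n r S × length S ≡ k × ((x : Fin n) → i x S ≤ 2)

-- Points 0–9 are the pairs 12, 13, 14, 15, 23, 24, 25, 34, 35, 45 of the five sets;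
-- point 9 + j is private to set j.
K5 : List (Subset 15)
K5 = map (Vec.map (1 ≡ᵇ_))
  ( (1 ∷ 1 ∷ 1 ∷ 1 ∷ 0 ∷ 0 ∷ 0 ∷ 0 ∷ 0 ∷ 0 ∷ 1 ∷ 0 ∷ 0 ∷ 0 ∷ 0 ∷ [])
  ∷ (1 ∷ 0 ∷ 0 ∷ 0 ∷ 1 ∷ 1 ∷ 1 ∷ 0 ∷ 0 ∷ 0 ∷ 0 ∷ 1 ∷ 0 ∷ 0 ∷ 0 ∷ [])
  ∷ (0 ∷ 1 ∷ 0 ∷ 0 ∷ 1 ∷ 0 ∷ 0 ∷ 1 ∷ 1 ∷ 0 ∷ 0 ∷ 0 ∷ 1 ∷ 0 ∷ 0 ∷ [])
  ∷ (0 ∷ 0 ∷ 1 ∷ 0 ∷ 0 ∷ 1 ∷ 0 ∷ 1 ∷ 0 ∷ 1 ∷ 0 ∷ 0 ∷ 0 ∷ 1 ∷ 0 ∷ [])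
  ∷ (0 ∷ 0 ∷ 0 ∷ 1 ∷ 0 ∷ 0 ∷ 1 ∷ 0 ∷ 1 ∷ 1 ∷ 0 ∷ 0 ∷ 0 ∷ 0 ∷ 1 ∷ [])
  ∷ [])

K5-degree≤2 : ∀ j → i j K5 ≤ 2
K5-degree≤2 = from-yes (all? (λ j → i j K5 ≤? 2))

K5-row : ∀ {c r a b d e} → 1≤ a ≤ c → 1≤ b ≤ c → 1≤ d ≤ c → 1≤ e ≤ c → 4 * c ≤ r →
         ∃ λ s → a + (b + (d + (e + (s + 0)))) ≡ r
K5-row {c} {r} {a} {b} {d} {e} (_ , a≤c) (_ , b≤c) (_ , d≤c) (_ , e≤c) 4c≤r =
  r ∸ row , trans (reassociate a b d e (r ∸ row))
                  (m+[n∸m]≡n (≤-trans (+-mono-≤ a≤c (+-mono-≤ b≤c (+-mono-≤ d≤c (+-mono-≤ e≤c z≤n)))) 4c≤r))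
  where
  row = a + (b + (d + (e + 0)))
  reassociate : ∀ a b d e s → a + (b + (d + (e + (s + 0)))) ≡ a + (b + (d + (e + 0))) + s
  reassociate = solve-∀

-- Both sides are written in the normal forms of Vec.sum ms + Vec.sum y and of the sum of the five
-- weights, so that the identity applies by unfolding.
K5-double-count :
  ∀ y₁₂ y₁₃ y₁₄ y₁₅ y₂₃ y₂₄ y₂₅ y₃₄ y₃₅ y₄₅ s₁ s₂ s₃ s₄ s₅ →
  (y₁₂ + (y₁₃ + (y₁₄ + (y₁₅ + (y₂₃ + (y₂₄ + (y₂₅ + (y₃₄ + (y₃₅ + (y₄₅ + (s₁ + (s₂ + (s₃ + (s₄ + (s₅ + 0)))))))))))))))
  + (y₁₂ + (y₁₃ + (y₁₄ + (y₁₅ + (y₂₃ + (y₂₄ + (y₂₅ + (y₃₄ + (y₃₅ + (y₄₅ + 0))))))))))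
  ≡ (y₁₂ + (y₁₃ + (y₁₄ + (y₁₅ + (s₁ + 0)))))
  + ((y₁₂ + (y₂₃ + (y₂₄ + (y₂₅ + (s₂ + 0)))))
  + ((y₁₃ + (y₂₃ + (y₃₄ + (y₃₅ + (s₃ + 0)))))
  + ((y₁₄ + (y₂₄ + (y₃₄ + (y₄₅ + (s₄ + 0)))))
  + ((y₁₅ + (y₂₅ + (y₃₅ + (y₄₅ + (s₅ + 0))))) + 0))))
K5-double-count = solve-∀

m+[2r+t]≡5r⇒m+t≡3r : ∀ {m r t} → m + (2 * r + t) ≡ 5 * r → m + t ≡ 3 * r
m+[2r+t]≡5r⇒m+t≡3r {m} {r} {t} eq = +-cancelʳ-≡ (2 * r) _ _ (begin
  m + t + 2 * r   ≡⟨ shuffle m r t ⟩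
  m + (2 * r + t) ≡⟨ eq ⟩
  5 * r           ≡⟨ split r ⟩
  3 * r + 2 * r   ∎)
  where
  open ≡-Reasoning
  shuffle : ∀ m r t → m + t + 2 * r ≡ m + (2 * r + t)
  shuffle = solve-∀
  split : ∀ r → 5 * r ≡ 3 * r + 2 * r
  split = solve-∀

1≤+0≤ : ∀ {a c} → 1≤ a ≤ c → 1≤ a + 0 ≤ c
1≤+0≤ {a} {c} = subst (1≤_≤ c) (sym (+-identityʳ a))

K5-packing : ∀ {n r c} → n + suc c ≡ 3 * r → 4 * c ≤ r → (y : Vec ℕ 10) → VecAll.All (1≤_≤ c) y →
             Vec.sum y ≡ 2 * r + suc c → LowDegree2Packing n r 5
K5-packing {n} {r} {c} n+1+c≡3r 4c≤r
  y@(y₁₂ ∷ y₁₃ ∷ y₁₄ ∷ y₁₅ ∷ y₂₃ ∷ y₂₄ ∷ y₂₅ ∷ y₃₄ ∷ y₃₅ ∷ y₄₅ ∷ [])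
  (r₁₂ ∷ r₁₃ ∷ r₁₄ ∷ r₁₅ ∷ r₂₃ ∷ r₂₄ ∷ r₂₅ ∷ r₃₄ ∷ r₃₅ ∷ r₄₅ ∷ []) Σy≡2r+1+c
  with K5-row r₁₂ r₁₃ r₁₄ r₁₅ 4c≤r | K5-row r₁₂ r₂₃ r₂₄ r₂₅ 4c≤r | K5-row r₁₃ r₂₃ r₃₄ r₃₅ 4c≤r
     | K5-row r₁₄ r₂₄ r₃₄ r₄₅ 4c≤r | K5-row r₁₅ r₂₅ r₃₅ r₄₅ 4c≤r
... | s₁ , w₁≡r | s₂ , w₂≡r | s₃ , w₃≡r | s₄ , w₄≡r | s₅ , w₅≡r =
  subst (λ N → LowDegree2Packing N r 5) Σms≡n
    ( map (blowUp ms) K5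
    , blowUp-2packing {ms = ms} {ps = K5} (trans (cong (_+ suc c) Σms≡n) n+1+c≡3r) c<r
        (w₁≡r ∷ w₂≡r ∷ w₃≡r ∷ w₄≡r ∷ w₅≡r ∷ [])
        ( (1≤+0≤ r₁₂ ∷ 1≤+0≤ r₁₃ ∷ 1≤+0≤ r₁₄ ∷ 1≤+0≤ r₁₅ ∷ [])
        ∷ (1≤+0≤ r₂₃ ∷ 1≤+0≤ r₂₄ ∷ 1≤+0≤ r₂₅ ∷ [])
        ∷ (1≤+0≤ r₃₄ ∷ 1≤+0≤ r₃₅ ∷ [])
        ∷ (1≤+0≤ r₄₅ ∷ [])
        ∷ []
        ∷ [])
    , refl
    , λ x → subst (_≤ 2) (sym (i-blowUp ms x K5)) (K5-degree≤2 (block ms x)))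
  where
  ms = y ++ (s₁ ∷ s₂ ∷ s₃ ∷ s₄ ∷ s₅ ∷ [])
  c<r : c < r
  c<r = <-≤-trans (m<m+n c (≤-trans (≤-trans (proj₁ r₁₂) (proj₂ r₁₂)) (m≤m+n c _))) 4c≤r
  Σms≡n : Vec.sum ms ≡ n
  Σms≡n = +-cancelʳ-≡ (suc c) _ _ (trans (m+[2r+t]≡5r⇒m+t≡3r {Vec.sum ms} {r} (begin
    Vec.sum ms + (2 * r + suc c) ≡⟨ cong (Vec.sum ms +_) Σy≡2r+1+c ⟨
    Vec.sum ms + Vec.sum y       ≡⟨ K5-double-count y₁₂ y₁₃ y₁₄ y₁₅ y₂₃ y₂₄ y₂₅ y₃₄ y₃₅ y₄₅ s₁ s₂ s₃ s₄ s₅ ⟩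
    _ ≡⟨ cong₂ _+_ w₁≡r (cong₂ _+_ w₂≡r (cong₂ _+_ w₃≡r (cong₂ _+_ w₄≡r (cong (_+ 0) w₅≡r)))) ⟩
    5 * r                        ∎)) (sym n+1+c≡3r))
    where open ≡-Reasoning

5r≤k+n⇒2r+t≤k : ∀ {k n r t} → n + t ≡ 3 * r → 5 * r ≤ k + n → 2 * r + t ≤ k
5r≤k+n⇒2r+t≤k {k} {n} {r} {t} n+t≡3r 5r≤k+n = +-cancelʳ-≤ (3 * r) _ _ (begin
  2 * r + t + 3 * r ≡⟨ shuffle r t ⟩
  5 * r + t         ≤⟨ +-monoˡ-≤ t 5r≤k+n ⟩
  k + n + t         ≡⟨ +-assoc k n t ⟩
  k + (n + t)       ≡⟨ cong (k +_) n+t≡3r ⟩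
  k + 3 * r         ∎)
  where
  open ≤-Reasoning
  shuffle : ∀ r t → 2 * r + t + 3 * r ≡ 5 * r + t
  shuffle = solve-∀

mainTheorem13 : (r t : ℕ) → 3 ≤ r → 2 ≤ t → 4 * t ≤ r + 4 →
    ρ₂≥ (3 * r ∸ t) r 5 →
    ∃ λ S → Is2Packing (3 * r ∸ t) r S × length S ≡ 5 ×
      ((x : Fin (3 * r ∸ t)) → i x S ≤ 2)
mainTheorem13 r 1 _ (s≤s ()) _ _
mainTheorem13 r t@(suc (suc c)) _ _ 4t≤r+4 (S , packing , ∣S∣≡5) =
  let y , ranges , Σy≡2r+t = partition-positive 10 10≤2r+t 2r+t≤10[1+c]
  in K5-packing n+t≡3r 4[1+c]≤r y ranges Σy≡2r+t
  where
  4[1+c]≤r : 4 * suc c ≤ r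
  4[1+c]≤r = +-cancelˡ-≤ 4 _ _ (subst₂ _≤_ (*-suc 4 (suc c)) (+-comm r 4) 4t≤r+4)
  t≤4[1+c] : t ≤ 4 * suc c
  t≤4[1+c] = subst (t ≤_) (4[1+c]≡t+2+3c c) (m≤m+n t (2 + 3 * c))
    where
    4[1+c]≡t+2+3c : ∀ c → suc (suc c) + (2 + 3 * c) ≡ 4 * suc c
    4[1+c]≡t+2+3c = solve-∀
  n+t≡3r : 3 * r ∸ t + t ≡ 3 * r
  n+t≡3r = m∸n+n≡m (≤-trans t≤4[1+c] (≤-trans 4[1+c]≤r (m≤m+n r _)))
  10≤2r+t : 10 ≤ 2 * r + t
  10≤2r+t = +-mono-≤ (*-monoʳ-≤ 2 (≤-trans (*-monoʳ-≤ 4 (s≤s z≤n)) 4[1+c]≤r)) (s≤s (s≤s z≤n))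
  2r+t≤10[1+c] : 2 * r + t ≤ 10 * suc c
  2r+t≤10[1+c] = 5r≤k+n⇒2r+t≤k {r = r} n+t≡3r
    (subst (λ k → k * r ≤ (k C 2) * suc c + (3 * r ∸ t)) ∣S∣≡5 (2packing-size-bound n+t≡3r packing))
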